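{- Let $f\colon n\to m$ be a morphism of $\mathrm{Mat}_{\mathbb N}$. Then $\mathrm{mwd}(f)\le\mathrm{rank}(f)+1$. Moreover, if $f$ is not $\otimes$-decomposable (there are no $f_1,f_2$, both distinct from $f$, with $f=f_1\otimes f_2$), then $\mathrm{rank}(f)\le\mathrm{mwd}(f)$.
   Context: $\mathrm{Mat}_{\mathbb N}$ is the prop (strict symmetric monoidal category with objects the natural numbers, $m\otimes n=m+n$) whose morphisms $n\to m$ are $m\times n$ matrices over $\mathbb N$; the composite of $A\colon n\to k$ followed by $B\colon k\to m$ is $B\cdot A$; $A\otimes B=\begin{pmatrix}A&0\\0&B\end{pmatrix}$. Rank: $\mathrm{rank}(A)=\min\{k:A=C\cdot B,\ B\in\mathrm{Mat}_{\mathbb N}(k,n),\ C\in\mathrm{Mat}_{\mathbb N}(m,k)\}$ for $A\in\mathrm{Mat}_{\mathbb N}(m,n)$. Atoms: $\mathrm{cp}_1=\begin{pmatrix}1\\1\end{pmatrix}\colon1\to2$, $\mathrm{del}_1\colon1\to0$ (the $0\times1$ matrix), $\mathrm{add}_1=(1\ 1)\colon2\to1$, $\mathrm{zero}_1\colon0\to1$ (the $1\times0$ matrix), $\sigma_{1,1}=\begin{pmatrix}0&1\\1&0\end{pmatrix}$, $\mathrm{id}_1=(1)$. Weights: $w(n)=n$ on objects, $w(g)=\max\{m,n\}$ for an atom $g\colon n\to m$. Monoidal decompositions $D(f)$ of $f\colon a\to b$: a leaf $(f)$ if $f$ is an atom; $(d_1\otimes d_2)$ with $d_i\in D(f_i)$,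 $f=f_1\otimes f_2$; $(d_1;_jd_2)$ with $d_1\in D(f_1\colon a\to j)$, $d_2\in D(f_2\colon j\to b)$, $f$ the composite of $f_1$ then $f_2$. Width: $\mathrm{wd}((f))=w(f)$, $\mathrm{wd}(d_1\otimes d_2)=\max\{\mathrm{wd}(d_1),\mathrm{wd}(d_2)\}$, $\mathrm{wd}(d_1;_jd_2)=\max\{\mathrm{wd}(d_1),j,\mathrm{wd}(d_2)\}$; $\mathrm{mwd}(f)=\min_{d\in D(f)}\mathrm{wd}(d)$. -}

module Defs where

open import Data.Nat using (ℕ; zero; suc; _+_; _*_; _≤_; _⊔_)
open import Data.Fin using (Fin; splitAt)
import Data.Fin as F
open import Data.Sum using (_⊎_; inj₁; inj₂)
open import Data.Product using (Σ; Σ-syntax; _×_; _,_)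
open import Relation.Binary.PropositionalEquality using (_≡_; refl)
open import Relation.Nullary using (¬_)

-- A morphism n → m of Mat_ℕ is an m × n matrix over ℕ (m rows, n columns).
Mat : ℕ → ℕ → Set
Mat m n = Fin m → Fin n → ℕ

sumFin : ∀ K → (Fin K → ℕ) → ℕ
sumFin zero    g = 0
sumFin (suc K) g = g F.zero + sumFin K (λ k → g (F.suc k))

-- Matrix product B · A (composite of A : n → k followed by B : k → m).
_·_ : ∀ {m k n} → Mat m k → Mat k n → Mat m n
_·_ {k = k} B A i j = sumFin k (λ l → B i l * A l j)

_⊗_ : ∀ {m₁ n₁ m₂ n₂} → Mat m₁ n₁ → Mat m₂ n₂ → Mat (m₁ + m₂) (n₁ + n₂)
_⊗_ {m₁} {n₁} A B i j with splitAt m₁ i | splitAt n₁ j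
... | inj₁ i₁ | inj₁ j₁ = A i₁ j₁
... | inj₁ _  | inj₂ _  = 0
... | inj₂ _  | inj₁ _  = 0
... | inj₂ i₂ | inj₂ j₂ = B i₂ j₂

_≈_ : ∀ {m n} → Mat m n → Mat m n → Set
A ≈ B = ∀ i j → A i j ≡ B i j

_≋_ : ∀ {m n m' n'} → Mat m n → Mat m' n' → Set
_≋_ {m} {n} {m'} {n'} A B =
  Σ (m ≡ m') λ { refl → Σ (n ≡ n') λ { refl → A ≈ B } }

FactorsThrough : ∀ {m n} → Mat m n → ℕ → Set
FactorsThrough {m} {n} f k = Σ[ B ∈ Mat k n ] Σ[ C ∈ Mat m k ] (C · B) ≈ f

IsRank : ∀ {m n} → Mat m n → ℕ → Set
IsRank f r = FactorsThrough f r × (∀ k → FactorsThrough f k → r ≤ k)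

Decomposable : ∀ {m n} → Mat m n → Set
Decomposable {m} {n} f =
  Σ[ m₁ ∈ ℕ ] Σ[ n₁ ∈ ℕ ] Σ[ m₂ ∈ ℕ ] Σ[ n₂ ∈ ℕ ]
  Σ[ f₁ ∈ Mat m₁ n₁ ] Σ[ f₂ ∈ Mat m₂ n₂ ]
    ((f₁ ⊗ f₂) ≋ f × ¬ (f₁ ≋ f) × ¬ (f₂ ≋ f))

-- Atoms g : n → m (indexed Atom n m).
data Atom : ℕ → ℕ → Set where
  cp₁   : Atom 1 2
  del₁  : Atom 1 0
  add₁  : Atom 2 1
  zero₁ : Atom 0 1
  σ₁₁   : Atom 2 2
  id₁   : Atom 1 1

atomMat : ∀ {n m} → Atom n m → Mat m n
atomMat cp₁   _ _ = 1
atomMat del₁  () _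
atomMat add₁  _ _ = 1
atomMat zero₁ _ ()
atomMat σ₁₁   F.zero       F.zero       = 0
atomMat σ₁₁   F.zero       (F.suc _)    = 1
atomMat σ₁₁   (F.suc _)    F.zero       = 1
atomMat σ₁₁   (F.suc _)    (F.suc _)    = 0
atomMat id₁   _ _ = 1

weight : ∀ {n m} → Atom n m → ℕ
weight {n} {m} _ = m ⊔ n

data Decomp : ℕ → ℕ → Set where
  leaf : ∀ {n m} → Atom n m → Decomp n m
  tens : ∀ {n₁ m₁ n₂ m₂} → Decomp n₁ m₁ → Decomp n₂ m₂ → Decomp (n₁ + n₂) (m₁ + m₂)
  seq  : ∀ {n m} (j : ℕ) → Decomp n j → Decomp j m → Decomp n m

⟦_⟧ : ∀ {n m} → Decomp n m → Mat m n
⟦ leaf g ⟧      = atomMat g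
⟦ tens d₁ d₂ ⟧  = ⟦ d₁ ⟧ ⊗ ⟦ d₂ ⟧
⟦ seq j d₁ d₂ ⟧ = ⟦ d₂ ⟧ · ⟦ d₁ ⟧

_∈D_ : ∀ {n m} → Decomp n m → Mat m n → Set
d ∈D f = ⟦ d ⟧ ≈ f

wd : ∀ {n m} → Decomp n m → ℕ
wd (leaf g)       = weight g
wd (tens d₁ d₂)   = wd d₁ ⊔ wd d₂
wd (seq j d₁ d₂)  = wd d₁ ⊔ j ⊔ wd d₂

{-# OPTIONS --safe #-}
module Submission where

-- Upper bound: from a factorisation f = C · B through r, build a decomposition
-- that applies B column by column and then C row by row, never holding more
-- than r + 1 wires.  A column b of B is added into r accumulator wires while the
-- input x is carried along by the gadget (x , y) ↦ (b x + y , x) of width 3;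
-- dually a row c of C is computed as a dot product pushed in front of its own
-- r inputs.  Lower bound: at a ⊗-node of a decomposition of an indecomposable f
-- one factor denotes f itself, so descending we reach a leaf, which factors f
-- through its codomain, or a composite through j, which factors f through j;
-- in both cases rank f ≤ width.

open import Defs
open import Data.Nat using (ℕ; zero; suc; _+_; _*_; _≤_; _⊔_; z≤n; s≤s; _≤?_)
open import Data.Nat.Properties
  using ( +-*-semiring; +-assoc; +-identityʳ; *-identityˡ; *-assoc; *-comm
        ; ≤-refl; ≤-trans; <⇒≤; n≤1+n; m≤m+n; m≤m⊔n; m≤n⊔m; ⊔-lub)
open import Algebra.Properties.Semiring.Sum +-*-semiring
  using (sum; sum-syntax; sum-cong-≗; sum-replicate-zero; ∑-comm; *-distribˡ-sum; *-distribʳ-sum)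
open import Data.Fin using (Fin; splitAt; _↑ˡ_; _↑ʳ_)
import Data.Fin as F
open import Data.Fin.Patterns using (0F; 1F)
open import Data.Fin.Properties using (splitAt-↑ˡ; splitAt-↑ʳ)
open import Data.Vec.Functional using (Vector; _∷_; []; _++_; take; drop)
open import Data.Vec.Functional.Properties using (++-cong)
open import Data.Product using (Σ-syntax; _×_; _,_)
open import Data.Sum using (_⊎_; inj₁; inj₂; [_,_]′)
open import Function using (_∘_)
open import Relation.Binary.PropositionalEquality
  using (_≡_; refl; sym; trans; cong; cong₂; _≗_; module ≡-Reasoning)
open import Relation.Nullary using (¬_; yes; no; contradiction)

infixr 7 _·ᵥ_

_·ᵥ_ : ∀ {m n} → Mat m n → Vector ℕ n → Vector ℕ m
_·ᵥ_ {n = n} A v i = ∑[ j < n ] (A i j * v j)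

sumFin≡sum : ∀ K (g : Fin K → ℕ) → sumFin K g ≡ sum g
sumFin≡sum zero    g = refl
sumFin≡sum (suc K) g = cong (g 0F +_) (sumFin≡sum K (g ∘ F.suc))

sum-take-drop : ∀ m {n} (v : Vector ℕ (m + n)) → sum v ≡ sum (take m v) + sum (drop m v)
sum-take-drop zero    v = refl
sum-take-drop (suc m) v =
  trans (cong (v 0F +_) (sum-take-drop m (v ∘ F.suc))) (sym (+-assoc (v 0F) _ _))

·ᵥ-· : ∀ {m k n} (B : Mat m k) (A : Mat k n) v → (B · A) ·ᵥ v ≗ B ·ᵥ A ·ᵥ v
·ᵥ-· {m} {k} {n} B A v i = begin
  ∑[ j < n ] (sumFin k (λ l → B i l * A l j) * v j)
    ≡⟨ sum-cong-≗ (λ j → cong (_* v j) (sumFin≡sum k _)) ⟩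
  ∑[ j < n ] ((∑[ l < k ] (B i l * A l j)) * v j)
    ≡⟨ sum-cong-≗ (λ j → *-distribʳ-sum (v j) (λ l → B i l * A l j)) ⟩
  ∑[ j < n ] ∑[ l < k ] (B i l * A l j * v j)
    ≡⟨ ∑-comm (λ j l → B i l * A l j * v j) ⟩
  ∑[ l < k ] ∑[ j < n ] (B i l * A l j * v j)
    ≡⟨ sum-cong-≗ (λ l → sum-cong-≗ (λ j → *-assoc (B i l) (A l j) (v j))) ⟩
  ∑[ l < k ] ∑[ j < n ] (B i l * (A l j * v j))
    ≡⟨ sum-cong-≗ (λ l → *-distribˡ-sum (B i l) (λ j → A l j * v j)) ⟨
  ∑[ l < k ] (B i l * (A ·ᵥ v) l) ∎
  where open ≡-Reasoning

blockEntry : ∀ {m₁ n₁ m₂ n₂} → Mat m₁ n₁ → Mat m₂ n₂ → Fin m₁ ⊎ Fin m₂ → Fin n₁ ⊎ Fin n₂ → ℕ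
blockEntry A B (inj₁ i) (inj₁ j) = A i j
blockEntry A B (inj₁ i) (inj₂ j) = 0
blockEntry A B (inj₂ i) (inj₁ j) = 0
blockEntry A B (inj₂ i) (inj₂ j) = B i j

⊗-blockEntry : ∀ {m₁ n₁ m₂ n₂} (A : Mat m₁ n₁) (B : Mat m₂ n₂) i j →
  (A ⊗ B) i j ≡ blockEntry A B (splitAt m₁ i) (splitAt n₁ j)
⊗-blockEntry {m₁} {n₁} A B i j with splitAt m₁ i | splitAt n₁ j
... | inj₁ _ | inj₁ _ = refl
... | inj₁ _ | inj₂ _ = refl
... | inj₂ _ | inj₁ _ = refl
... | inj₂ _ | inj₂ _ = refl

·ᵥ-⊗ : ∀ {m₁ n₁ m₂ n₂} (A : Mat m₁ n₁) (B : Mat m₂ n₂) v →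
  (A ⊗ B) ·ᵥ v ≗ (A ·ᵥ take n₁ v) ++ (B ·ᵥ drop n₁ v)
·ᵥ-⊗ {m₁} {n₁} {m₂} {n₂} A B v i = begin
  ∑[ j < n₁ + n₂ ] ((A ⊗ B) i j * v j)
    ≡⟨ sum-cong-≗ (λ j → cong (_* v j) (⊗-blockEntry A B i j)) ⟩
  ∑[ j < n₁ + n₂ ] (blockEntry A B s (splitAt n₁ j) * v j)
    ≡⟨ sum-take-drop n₁ _ ⟩
  ∑[ j < n₁ ] (blockEntry A B s (splitAt n₁ (j ↑ˡ n₂)) * take n₁ v j)
    + ∑[ j < n₂ ] (blockEntry A B s (splitAt n₁ (n₁ ↑ʳ j)) * drop n₁ v j)
    ≡⟨ cong₂ _+_
         (sum-cong-≗ (λ j → cong (λ t → blockEntry A B s t * take n₁ v j) (splitAt-↑ˡ n₁ j n₂)))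
         (sum-cong-≗ (λ j → cong (λ t → blockEntry A B s t * drop n₁ v j) (splitAt-↑ʳ n₁ n₂ j))) ⟩
  ∑[ j < n₁ ] (blockEntry A B s (inj₁ j) * take n₁ v j)
    + ∑[ j < n₂ ] (blockEntry A B s (inj₂ j) * drop n₁ v j)
    ≡⟨ blockRow s ⟩
  [ A ·ᵥ take n₁ v , B ·ᵥ drop n₁ v ]′ s ∎
  where
  open ≡-Reasoning
  s = splitAt m₁ i
  blockRow : ∀ s → ∑[ j < n₁ ] (blockEntry A B s (inj₁ j) * take n₁ v j)
                   + ∑[ j < n₂ ] (blockEntry A B s (inj₂ j) * drop n₁ v j)
                 ≡ [ A ·ᵥ take n₁ v , B ·ᵥ drop n₁ v ]′ s
  blockRow (inj₁ i₁) = trans (cong ((A ·ᵥ take n₁ v) i₁ +_) (sum-replicate-zero n₂)) (+-identityʳ _)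
  blockRow (inj₂ i₂) = cong (_+ (B ·ᵥ drop n₁ v) i₂) (sum-replicate-zero n₁)

idMat : ∀ {n} → Mat n n
idMat F.zero    F.zero    = 1
idMat F.zero    (F.suc _) = 0
idMat (F.suc _) F.zero    = 0
idMat (F.suc i) (F.suc j) = idMat i j

∑-idMat : ∀ K (i : Fin K) (g : Vector ℕ K) → ∑[ l < K ] (idMat i l * g l) ≡ g i
∑-idMat (suc K) F.zero    g =
  trans (cong₂ _+_ (*-identityˡ (g 0F)) (sum-replicate-zero K)) (+-identityʳ _)
∑-idMat (suc K) (F.suc i) g = ∑-idMat K i (g ∘ F.suc)

≈-from-·ᵥ : ∀ {m n} {A B : Mat m n} → (∀ v → A ·ᵥ v ≗ B ·ᵥ v) → A ≈ B
≈-from-·ᵥ {n = n} {A} {B} A≗B i j = begin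
  A i j             ≡⟨ column A ⟨
  (A ·ᵥ idMat j) i  ≡⟨ A≗B (idMat j) i ⟩
  (B ·ᵥ idMat j) i  ≡⟨ column B ⟩
  B i j             ∎
  where
  open ≡-Reasoning
  column : ∀ M → (M ·ᵥ idMat j) i ≡ M i j
  column M = trans (sum-cong-≗ (λ l → *-comm (M i l) (idMat j l))) (∑-idMat n j (M i))

factorsThrough-codomain : ∀ {m n} (f : Mat m n) → FactorsThrough f m
factorsThrough-codomain {m} f =
  f , idMat , λ i j → trans (sumFin≡sum m _) (∑-idMat m i (λ l → f l j))

infixr 6 _∥_

_∥_ : ∀ {n₁ m₁ n₂ m₂} → (Vector ℕ n₁ → Vector ℕ m₁) → (Vector ℕ n₂ → Vector ℕ m₂) →
      Vector ℕ (n₁ + n₂) → Vector ℕ (m₁ + m₂)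
(_∥_ {n₁} φ ψ) v = φ (take n₁ v) ++ ψ (drop n₁ v)

Realisable : ∀ {n m} → ℕ → (Vector ℕ n → Vector ℕ m) → Set
Realisable {n} {m} w φ = Σ[ d ∈ Decomp n m ] (∀ v → ⟦ d ⟧ ·ᵥ v ≗ φ v) × wd d ≤ w

module _ {w : ℕ} where

  seqᴿ : ∀ {n j m} {φ : Vector ℕ n → Vector ℕ j} {ψ : Vector ℕ j → Vector ℕ m} →
         j ≤ w → Realisable w φ → Realisable w ψ → Realisable w (ψ ∘ φ)
  seqᴿ {j = j} {φ = φ} j≤w (d₁ , d₁≗φ , d₁≤w) (d₂ , d₂≗ψ , d₂≤w) =
    seq j d₁ d₂ ,
    (λ v i → trans (·ᵥ-· ⟦ d₂ ⟧ ⟦ d₁ ⟧ v i)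
                   (trans (sum-cong-≗ (λ l → cong (⟦ d₂ ⟧ i l *_) (d₁≗φ v l))) (d₂≗ψ (φ v) i))) ,
    ⊔-lub (⊔-lub d₁≤w j≤w) d₂≤w

  infixr 6 _∥ᴿ_
  _∥ᴿ_ : ∀ {n₁ m₁ n₂ m₂} {φ : Vector ℕ n₁ → Vector ℕ m₁} {ψ : Vector ℕ n₂ → Vector ℕ m₂} →
         Realisable w φ → Realisable w ψ → Realisable w (φ ∥ ψ)
  (d₁ , d₁≗φ , d₁≤w) ∥ᴿ (d₂ , d₂≗ψ , d₂≤w) =
    tens d₁ d₂ ,
    (λ v i → trans (·ᵥ-⊗ ⟦ d₁ ⟧ ⟦ d₂ ⟧ v i) (++-cong _ _ (d₁≗φ _) (d₂≗ψ _) i)) ,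
    ⊔-lub d₁≤w d₂≤w

  congᴿ : ∀ {n m} {φ ψ : Vector ℕ n → Vector ℕ m} →
          (∀ v → φ v ≗ ψ v) → Realisable w φ → Realisable w ψ
  congᴿ φ≗ψ (d , d≗φ , d≤w) = d , (λ v i → trans (d≗φ v i) (φ≗ψ v i)) , d≤w

  module _ (1≤w : 1 ≤ w) where

    idᴿ : Realisable w (λ (v : Vector ℕ 1) (_ : Fin 1) → v 0F)
    idᴿ = leaf id₁ , (λ v i → trans (+-identityʳ _) (*-identityˡ _)) , 1≤w

    delᴿ : Realisable {1} {0} w (λ _ ())
    delᴿ = leaf del₁ , (λ v ()) , 1≤w

    zeroᴿ : Realisable w (λ (_ : Vector ℕ 0) (_ : Fin 1) → 0)
    zeroᴿ = leaf zero₁ , (λ v i → refl) , 1≤w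

    idsᴿ : ∀ k → Realisable w (λ (v : Vector ℕ k) → v)
    idsᴿ zero    = congᴿ (λ v ()) (seqᴿ 1≤w zeroᴿ delᴿ)
    idsᴿ (suc k) = congᴿ (λ v → λ { 0F → refl ; (F.suc i) → refl }) (idᴿ ∥ᴿ idsᴿ k)

    zerosᴿ : ∀ k → Realisable w (λ (_ : Vector ℕ 0) (_ : Fin k) → 0)
    zerosᴿ zero    = congᴿ (λ v ()) (idsᴿ 0)
    zerosᴿ (suc k) = congᴿ (λ v → λ { 0F → refl ; (F.suc i) → refl }) (zeroᴿ ∥ᴿ zerosᴿ k)

    delsᴿ : ∀ k → Realisable {k} {0} w (λ _ ())
    delsᴿ zero    = congᴿ (λ v ()) (idsᴿ 0)
    delsᴿ (suc k) = congᴿ (λ v ()) (delᴿ ∥ᴿ delsᴿ k)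

  module _ (2≤w : 2 ≤ w) where

    cpᴿ : Realisable w (λ (v : Vector ℕ 1) (_ : Fin 2) → v 0F)
    cpᴿ = leaf cp₁ , (λ v i → trans (+-identityʳ _) (*-identityˡ _)) , 2≤w

    addᴿ : Realisable w (λ (v : Vector ℕ 2) (_ : Fin 1) → v 0F + v 1F)
    addᴿ = leaf add₁ ,
      (λ v i → cong₂ _+_ (*-identityˡ (v 0F)) (trans (+-identityʳ (1 * v 1F)) (*-identityˡ _))) ,
      2≤w

    swapᴿ : Realisable w (λ (v : Vector ℕ 2) → v 1F ∷ v 0F ∷ [])
    swapᴿ = leaf σ₁₁ ,
      (λ v → λ { 0F → trans (+-identityʳ _) (*-identityˡ _)
               ; 1F → trans (+-identityʳ _) (*-identityˡ _) }) ,
      2≤w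

    scalarᴿ : ∀ b → Realisable w (λ (v : Vector ℕ 1) (_ : Fin 1) → b * v 0F)
    scalarᴿ zero    = seqᴿ z≤n (delᴿ (<⇒≤ 2≤w)) (zeroᴿ (<⇒≤ 2≤w))
    scalarᴿ (suc b) = seqᴿ 2≤w cpᴿ (seqᴿ 2≤w (idᴿ (<⇒≤ 2≤w) ∥ᴿ scalarᴿ b) addᴿ)

  shearᴿ : 3 ≤ w → ∀ b → Realisable w (λ (v : Vector ℕ 2) → (b * v 0F + v 1F) ∷ v 0F ∷ [])
  shearᴿ 3≤w b =
    congᴿ (λ v → λ { 0F → refl ; 1F → refl })
      (seqᴿ 3≤w (cpᴿ 2≤w ∥ᴿ idᴿ 1≤w)
        (seqᴿ 3≤w (scalarᴿ 2≤w b ∥ᴿ swapᴿ 2≤w) (addᴿ 2≤w ∥ᴿ idᴿ 1≤w)))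
    where
    2≤w = <⇒≤ 3≤w
    1≤w = <⇒≤ 2≤w

  -- r = 1 is a separate case because shearᴿ needs three wires.
  axpyᴿ : ∀ r → suc r ≤ w → (b : Vector ℕ r) →
          Realisable w (λ v i → b i * v 0F + v (F.suc i))
  axpyᴿ zero          h b = congᴿ (λ v ()) (delᴿ h)
  axpyᴿ (suc zero)    h b =
    congᴿ (λ v → λ { 0F → refl }) (seqᴿ h (scalarᴿ h (b 0F) ∥ᴿ idᴿ (<⇒≤ h)) (addᴿ h))
  axpyᴿ (suc (suc r)) h b =
    congᴿ (λ v → λ { 0F → refl ; (F.suc i) → refl })
      (seqᴿ h (shearᴿ (≤-trans (m≤m+n 3 r) h) (b 0F) ∥ᴿ idsᴿ 1≤w (suc r))
              (idᴿ 1≤w ∥ᴿ axpyᴿ (suc r) (<⇒≤ h) (b ∘ F.suc)))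
    where 1≤w = ≤-trans (s≤s z≤n) h

  dotᴿ : ∀ r → suc r ≤ w → (c : Vector ℕ r) →
         Realisable w (λ v → ∑[ j < r ] (c j * v j) ∷ v)
  dotᴿ zero          h c = congᴿ (λ v → λ { 0F → refl }) (zeroᴿ h)
  dotᴿ (suc zero)    h c =
    congᴿ (λ v → λ { 0F → sym (+-identityʳ _) ; 1F → refl })
      (seqᴿ h (cpᴿ h) (scalarᴿ h (c 0F) ∥ᴿ idᴿ (<⇒≤ h)))
  dotᴿ (suc (suc r)) h c =
    congᴿ (λ v → λ { 0F → refl ; 1F → refl ; (F.suc (F.suc i)) → refl })
      (seqᴿ h (idᴿ 1≤w ∥ᴿ dotᴿ (suc r) (<⇒≤ h) (c ∘ F.suc))
              (shearᴿ (≤-trans (m≤m+n 3 r) h) (c 0F) ∥ᴿ idsᴿ 1≤w (suc r)))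
    where 1≤w = ≤-trans (s≤s z≤n) h

columnsᴿ : ∀ {r n} (B : Mat r n) → Realisable (suc r) (B ·ᵥ_)
columnsᴿ {r} {zero}  B = zerosᴿ (s≤s z≤n) r
columnsᴿ {r} {suc n} B =
  seqᴿ ≤-refl (idᴿ (s≤s z≤n) ∥ᴿ columnsᴿ (λ i j → B i (F.suc j))) (axpyᴿ r ≤-refl (λ i → B i 0F))

rowsᴿ : ∀ {m r} (C : Mat m r) → Realisable (suc r) (C ·ᵥ_)
rowsᴿ {zero}  {r} C = congᴿ (λ v ()) (delsᴿ (s≤s z≤n) r)
rowsᴿ {suc m} {r} C =
  congᴿ (λ v → λ { 0F → refl ; (F.suc i) → refl })
    (seqᴿ ≤-refl (dotᴿ r ≤-refl (C 0F)) (idᴿ (s≤s z≤n) ∥ᴿ rowsᴿ (C ∘ F.suc)))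

factorsThrough⇒decomp-wd≤suc : ∀ {m n} (f : Mat m n) k → FactorsThrough f k →
  Σ[ d ∈ Decomp n m ] (d ∈D f × wd d ≤ suc k)
factorsThrough⇒decomp-wd≤suc f k (B , C , C·B≈f)
  with seqᴿ (n≤1+n k) (columnsᴿ B) (rowsᴿ C)
... | d , d≗C·B , d≤suck = d , (λ i j → trans (d≈C·B i j) (C·B≈f i j)) , d≤suck
  where
  d≈C·B : ⟦ d ⟧ ≈ (C · B)
  d≈C·B = ≈-from-·ᵥ λ v i → trans (d≗C·B v i) (sym (·ᵥ-· C B v i))

rank≤wd : ∀ {m n} {f : Mat m n} {r} → IsRank f r → ¬ Decomposable f →
  ∀ {n' m'} (d : Decomp n' m') → ⟦ d ⟧ ≋ f → r ≤ wd d
rank≤wd {m} {n} {f} (_ , minimal) _ (leaf g) (refl , refl , _) =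
  ≤-trans (minimal m (factorsThrough-codomain f)) (m≤m⊔n m n)
rank≤wd (_ , minimal) _ (seq j d₁ d₂) (refl , refl , d≈f) =
  ≤-trans (minimal j (⟦ d₁ ⟧ , ⟦ d₂ ⟧ , d≈f)) (≤-trans (m≤n⊔m (wd d₁) j) (m≤m⊔n _ (wd d₂)))
rank≤wd {r = r} rank indec (tens {n₁} {m₁} {n₂} {m₂} d₁ d₂) d≋f with r ≤? wd d₁ ⊔ wd d₂
... | yes r≤wd = r≤wd
... | no  r≰wd = contradiction
  (m₁ , n₁ , m₂ , n₂ , ⟦ d₁ ⟧ , ⟦ d₂ ⟧ , d≋f ,
   (λ d₁≋f → r≰wd (≤-trans (rank≤wd rank indec d₁ d₁≋f) (m≤m⊔n _ _))) ,
   (λ d₂≋f → r≰wd (≤-trans (rank≤wd rank indec d₂ d₂≋f) (m≤n⊔m _ _))))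
  indec

proposition4p8 : ∀ {n m} (f : Mat m n) (r : ℕ) → IsRank f r →
    (Σ[ d ∈ Decomp n m ] (d ∈D f × wd d ≤ suc r))
    × (¬ Decomposable f → ∀ (d : Decomp n m) → d ∈D f → r ≤ wd d)
proposition4p8 f r rank@(factors , _) =
  factorsThrough⇒decomp-wd≤suc f r factors ,
  λ indec d d∈Df → rank≤wd rank indec d (refl , refl , d∈Df)
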